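{- Let $\mathcal S=(n,I,J,K,\psi,\pi)$ be a system and let $(y_i)_{i=0}^n$ be a sequence corresponding to $\mathcal S$. Then $0\le y_i\le y_{i+1}$ for all $1\le i\le n-1$. If, in addition, $(y_i)$ is admissible for $\mathcal S$, then $0\le y_i\le y_{i+1}\le 2y_i$ for all $0\le i<n$.
   Context: A system is a tuple $\mathcal S=(n,I,J,K,\psi,\pi)$ where $n\ge2$ is an integer, $I,J,K$ are pairwise disjoint subsets of $\{2,\dots,n\}$ with $|I|=|J|\ge|K|$, $\psi:I\to J$ is a bijection, $\pi:I\to K$ is a surjection, and $i<\pi(i)<\psi(i)$ for all $i\in I$. Indices in $I$, $J$, $K$ are called exceptional, penalty and fine; other indices of $\{2,\dots,n\}$ are ordinary. For $k\in K$ put $d(k)=\min\pi^{ -1}(k)$. For $2\le r\le n$, $\theta(r)=r-2$ if $r$ is ordinary, $r-1$ if exceptional, $\psi^{ -1}(r)-1$ if penalty, $d(r)-2$ if fine. A sequence $(x_i)_{i=0}^n$ of nonnegative real numbers corresponds to $\mathcal S$ if $x_r=x_{r-1}+x_{\theta(r)}$ for all $2\le r\le n$; it is admissible for $\mathcal S$ if moreover $0\le x_0\le x_1\le 2x_0$. -}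

module Defs where

open import Level using (Level; _⊔_) renaming (suc to lsuc)
open import Data.Nat as ℕ using (ℕ; zero; suc; _∸_; _<_) renaming (_≤_ to _≤ℕ_)
open import Data.Fin using (Fin; toℕ)
open import Data.Fin.Subset using (Subset; _∈_; _∉_; ∣_∣)
open import Data.Product using (_×_; ∃)
open import Data.Empty using (⊥)
open import Relation.Nullary using (¬_)
open import Relation.Binary.PropositionalEquality using (_≡_)
open import Relation.Binary.Structures using (IsTotalOrder)
open import Algebra.Bundles using (CommutativeRing)

-- Ordered fields (the reals are one; agda-stdlib has no reals).
-- The statement is proved for every ordered field, which includes ℝ.

record OrderedField (c ℓ : Level) : Set (lsuc (c ⊔ ℓ)) where
  field
    commutativeRing : CommutativeRing c ℓ
  open CommutativeRing commutativeRing public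
  field
    _≤ᶠ_        : Carrier → Carrier → Set ℓ
    isTotalOrder : IsTotalOrder _≈_ _≤ᶠ_
    +-monoʳ-≤ᶠ   : ∀ {x y} z → x ≤ᶠ y → (x + z) ≤ᶠ (y + z)
    *-nonneg     : ∀ {x y} → 0# ≤ᶠ x → 0# ≤ᶠ y → 0# ≤ᶠ (x * y)
    0≉1          : ¬ (0# ≈ 1#)
    inverse      : ∀ x → ¬ (x ≈ 0#) → ∃ λ y → (x * y) ≈ 1#

-- Indices 0..n are Fin (suc n);
-- I, J, K are subsets of {0..n} contained in {2..n};
-- ψ, π are functions on Fin (suc n) whose restriction to I is the
-- relevant bijection I → J / surjection I → K.

record System : Set where
  field
    n     : ℕ
    2≤n   : 2 ≤ℕ n
    I J K : Subset (suc n)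
    ψ π   : Fin (suc n) → Fin (suc n)
    I-range : ∀ i → i ∈ I → 2 ≤ℕ toℕ i
    J-range : ∀ i → i ∈ J → 2 ≤ℕ toℕ i
    K-range : ∀ i → i ∈ K → 2 ≤ℕ toℕ i
    I∩J : ∀ i → i ∈ I → i ∈ J → ⊥
    I∩K : ∀ i → i ∈ I → i ∈ K → ⊥
    J∩K : ∀ i → i ∈ J → i ∈ K → ⊥
    ∣I∣≡∣J∣ : ∣ I ∣ ≡ ∣ J ∣
    ∣K∣≤∣J∣ : ∣ K ∣ ≤ℕ ∣ J ∣
    ψ-into : ∀ i → i ∈ I → ψ i ∈ J
    ψ-inj  : ∀ i i′ → i ∈ I → i′ ∈ I → ψ i ≡ ψ i′ → i ≡ i′
    ψ-onto : ∀ j → j ∈ J → ∃ λ i → i ∈ I × ψ i ≡ j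
    π-into : ∀ i → i ∈ I → π i ∈ K
    π-onto : ∀ k → k ∈ K → ∃ λ i → i ∈ I × π i ≡ k
    order  : ∀ i → i ∈ I → toℕ i < toℕ (π i) × toℕ (π i) < toℕ (ψ i)

-- θ as a relation: Θ S r t  means  θ(r) = t  (θ is single-valued on
-- {2..n}, since the four kinds of index are mutually exclusive, ψ is
-- injective and d(r) = min π⁻¹(r) is unique).
data Θ (S : System) (r : Fin (suc (System.n S))) : ℕ → Set where
  ordinary    : r ∉ System.I S → r ∉ System.J S → r ∉ System.K S →
                Θ S r (toℕ r ∸ 2)
  exceptional : r ∈ System.I S → Θ S r (toℕ r ∸ 1)
  penalty     : r ∈ System.J S → ∀ i → i ∈ System.I S → System.ψ S i ≡ r →
                Θ S r (toℕ i ∸ 1)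
  fine        : r ∈ System.K S → ∀ i → i ∈ System.I S → System.π S i ≡ r →
                (∀ i′ → i′ ∈ System.I S → System.π S i′ ≡ r → toℕ i ≤ℕ toℕ i′) →
                Θ S r (toℕ i ∸ 2)

module _ {c ℓ} (F : OrderedField c ℓ) where
  open OrderedField F

  -- (x_i)_{i=0}^n (entries beyond n are ignored) corresponds to S
  record Corresponds (S : System) (x : ℕ → Carrier) : Set (c ⊔ ℓ) where
    field
      nonneg : ∀ i → i ≤ℕ System.n S → 0# ≤ᶠ x i
      recur  : ∀ (r : Fin (suc (System.n S))) → 2 ≤ℕ toℕ r → ∀ t → Θ S r t →
               x (toℕ r) ≈ (x (toℕ r ∸ 1) + x t)

  record Admissible (S : System) (x : ℕ → Carrier) : Set (c ⊔ ℓ) where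
    field
      corresponds : Corresponds S x
      x₀≤x₁  : x 0 ≤ᶠ x 1
      x₁≤2x₀ : x 1 ≤ᶠ (x 0 + x 0)

-- Every index r ∈ {2,…,n} has a value θ(r) < r, so y_r = y_{r-1} + y_{θ(r)} with
-- y_{θ(r)} ≥ 0 gives y_{r-1} ≤ y_r.  Admissibility adds y_0 ≤ y_1, making y monotone
-- on all of {0,…,n}; then y_{θ(r)} ≤ y_{r-1}, so y_r ≤ 2 y_{r-1}, and y_1 ≤ 2 y_0 is
-- part of admissibility.
module Submission where

open import Defs
open import Data.Nat using (ℕ; zero; suc; _∸_; _<_; z≤n; s≤s) renaming (_≤_ to _≤ℕ_)
import Data.Nat.Properties as ℕ
open import Data.Fin using (Fin; toℕ; fromℕ<)
open import Data.Fin.Properties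
  using (_≟_; ¬∀⟶∃¬-smallest; toℕ-injective; toℕ-inject; toℕ-fromℕ<)
open import Data.Fin.Subset.Properties using (_∈?_)
open import Data.Product using (_×_; ∃; _,_; proj₁; proj₂)
open import Data.Sum using (inj₁; inj₂)
open import Relation.Binary.Core using (Rel)
open import Relation.Binary.Definitions using (Reflexive; Transitive)
open import Relation.Binary.PropositionalEquality as ≡ using (refl; subst)
open import Relation.Binary.Structures using (IsTotalOrder)
open import Relation.Nullary using (¬_)
open import Relation.Nullary.Decidable using (yes; no; ¬?; _×-dec_; decidable-stable)
open import Relation.Unary using (Pred; Decidable)

m≤n∸1⇒m<n : ∀ {m n} → 1 ≤ℕ n → m ≤ℕ n ∸ 1 → m < n
m≤n∸1⇒m<n (s≤s _) m≤n∸1 = s≤s m≤n∸1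

least-witness : ∀ {n p} {P : Pred (Fin n) p} → Decidable P → ∃ P →
                ∃ λ i → P i × (∀ j → P j → toℕ i ≤ℕ toℕ j)
least-witness {n} {P = P} P? (i , Pi)
  with ¬∀⟶∃¬-smallest n (λ j → ¬ P j) (λ j → ¬? (P? j)) (λ ∀¬P → ∀¬P i Pi)
... | m , ¬¬Pm , ¬P-below-m = m , decidable-stable (P? m) ¬¬Pm , minimal
  where
  minimal : ∀ j → P j → toℕ m ≤ℕ toℕ j
  minimal j Pj = ℕ.≮⇒≥ λ j<m →
    ¬P-below-m (fromℕ< j<m)
      (subst P (≡.sym (toℕ-injective (≡.trans (toℕ-inject _) (toℕ-fromℕ< j<m)))) Pj)

module _ {a ℓ} {A : Set a} {_≲_ : Rel A ℓ}
         (≲-refl : Reflexive _≲_) (≲-trans : Transitive _≲_) (f : ℕ → A) where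

  stepwise-monotone : ∀ {n} → (∀ i → i < n → f i ≲ f (suc i)) →
                      ∀ {i j} → i ≤ℕ j → j ≤ℕ n → f i ≲ f j
  stepwise-monotone step {j = zero} z≤n _ = ≲-refl
  stepwise-monotone step {j = suc j} i≤1+j 1+j≤n with ℕ.m≤n⇒m<n∨m≡n i≤1+j
  ... | inj₁ (s≤s i≤j) = ≲-trans (stepwise-monotone step i≤j (ℕ.<⇒≤ 1+j≤n)) (step j 1+j≤n)
  ... | inj₂ refl = ≲-refl

module _ (S : System) where
  open System S

  θ-defined : (r : Fin (suc n)) → 2 ≤ℕ toℕ r → ∃ λ t → Θ S r t × t < toℕ r
  θ-defined r 2≤r with r ∈? I | r ∈? J | r ∈? K
  ... | yes r∈I | _ | _ =
    toℕ r ∸ 1 , exceptional r∈I , ℕ.∸-monoʳ-< (s≤s z≤n) (ℕ.≤-trans (ℕ.n≤1+n 1) 2≤r)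
  ... | no _ | yes r∈J | _ with ψ-onto r r∈J
  ...   | i , i∈I , refl =
    toℕ i ∸ 1 , penalty r∈J i i∈I refl ,
    ℕ.≤-<-trans (ℕ.m∸n≤m _ 1) (ℕ.<-trans (proj₁ (order i i∈I)) (proj₂ (order i i∈I)))
  θ-defined r 2≤r | no r∉I | no r∉J | no r∉K =
    toℕ r ∸ 2 , ordinary r∉I r∉J r∉K , ℕ.∸-monoʳ-< (s≤s z≤n) 2≤r
  θ-defined r 2≤r | no _ | no _ | yes r∈K
    with least-witness (λ i → (i ∈? I) ×-dec (π i ≟ r)) (π-onto r r∈K)
  ... | d , (d∈I , refl) , minimal =
    toℕ d ∸ 2 , fine r∈K d d∈I refl (λ i i∈I πi≡r → minimal i (i∈I , πi≡r)) ,
    ℕ.≤-<-trans (ℕ.m∸n≤m _ 2) (proj₁ (order d d∈I))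

module OrderedFieldProperties {c ℓ} (F : OrderedField c ℓ) where
  open OrderedField F
  open IsTotalOrder isTotalOrder public
    using (≲-respˡ-≈; ≲-respʳ-≈) renaming (refl to ≤ᶠ-refl; trans to ≤ᶠ-trans)

  +-monoˡ-≤ᶠ : ∀ x {y z} → y ≤ᶠ z → (x + y) ≤ᶠ (x + z)
  +-monoˡ-≤ᶠ x {y} {z} y≤z = ≲-respˡ-≈ (+-comm y x) (≲-respʳ-≈ (+-comm z x) (+-monoʳ-≤ᶠ x y≤z))

  x≤x+y : ∀ x {y} → 0# ≤ᶠ y → x ≤ᶠ (x + y)
  x≤x+y x 0≤y = ≲-respˡ-≈ (+-identityʳ x) (+-monoˡ-≤ᶠ x 0≤y)

module CorrespondingSequence {c ℓ} (F : OrderedField c ℓ) (S : System)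
                             (y : ℕ → OrderedField.Carrier F) (C : Corresponds F S y) where
  open OrderedField F
  open OrderedFieldProperties F
  open System S
  open Corresponds C

  Recurrence : ℕ → Set ℓ
  Recurrence m = ∃ λ t → t < m × y m ≈ (y (m ∸ 1) + y t)

  recurrence-at : (r : Fin (suc n)) → 2 ≤ℕ toℕ r → Recurrence (toℕ r)
  recurrence-at r 2≤r with θ-defined S r 2≤r
  ... | t , θr≡t , t<r = t , t<r , recur r 2≤r t θr≡t

  recurrence : ∀ i → 1 ≤ℕ i → i < n → ∃ λ t → t ≤ℕ i × y (suc i) ≈ (y i + y t)
  recurrence i 1≤i i<n
    with subst Recurrence (toℕ-fromℕ< 1+i<1+n)
           (recurrence-at (fromℕ< 1+i<1+n) (subst (2 ≤ℕ_) (≡.sym (toℕ-fromℕ< 1+i<1+n)) (s≤s 1≤i)))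
    where 1+i<1+n = s≤s i<n
  ... | t , t<1+i , y₁₊ᵢ≈ = t , ℕ.≤-pred t<1+i , y₁₊ᵢ≈

  increasing : ∀ i → 1 ≤ℕ i → i < n → y i ≤ᶠ y (suc i)
  increasing i 1≤i i<n with recurrence i 1≤i i<n
  ... | t , t≤i , y₁₊ᵢ≈ = ≲-respʳ-≈ (sym y₁₊ᵢ≈) (x≤x+y (y i) (nonneg t (ℕ.≤-trans t≤i (ℕ.<⇒≤ i<n))))

  module _ (A : Admissible F S y) where
    open Admissible A using (x₀≤x₁; x₁≤2x₀)

    increasing₀ : ∀ i → i < n → y i ≤ᶠ y (suc i)
    increasing₀ zero    _ = x₀≤x₁
    increasing₀ (suc i)   = increasing (suc i) (s≤s z≤n)

    monotone : ∀ {i j} → i ≤ℕ j → j ≤ℕ n → y i ≤ᶠ y j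
    monotone = stepwise-monotone {_≲_ = _≤ᶠ_} ≤ᶠ-refl ≤ᶠ-trans y increasing₀

    at-most-doubling : ∀ i → i < n → y (suc i) ≤ᶠ (y i + y i)
    at-most-doubling zero    _   = x₁≤2x₀
    at-most-doubling (suc i) i<n with recurrence (suc i) (s≤s z≤n) i<n
    ... | t , t≤i , y₁₊ᵢ≈ = ≲-respˡ-≈ (sym y₁₊ᵢ≈) (+-monoˡ-≤ᶠ (y (suc i)) (monotone t≤i (ℕ.<⇒≤ i<n)))

proposition4p3 : ∀ {c ℓ} (F : OrderedField c ℓ) (S : System)
    (y : ℕ → OrderedField.Carrier F) →
    Corresponds F S y →
    (∀ i → 1 ≤ℕ i → i ≤ℕ System.n S ∸ 1 →
      OrderedField._≤ᶠ_ F (OrderedField.0# F) (y i)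
      × OrderedField._≤ᶠ_ F (y i) (y (suc i)))
    × (Admissible F S y → ∀ i → i < System.n S →
      OrderedField._≤ᶠ_ F (OrderedField.0# F) (y i)
      × OrderedField._≤ᶠ_ F (y i) (y (suc i))
      × OrderedField._≤ᶠ_ F (y (suc i)) (OrderedField._+_ F (y i) (y i)))
proposition4p3 F S y C =
  (λ i 1≤i i≤n∸1 → let i<n = m≤n∸1⇒m<n 1≤n i≤n∸1 in
     nonneg i (ℕ.<⇒≤ i<n) , increasing i 1≤i i<n) ,
  λ A i i<n → nonneg i (ℕ.<⇒≤ i<n) , increasing₀ A i i<n , at-most-doubling A i i<n
  where
  open System S using (2≤n)
  open Corresponds C using (nonneg)
  open CorrespondingSequence F S y C
  1≤n : 1 ≤ℕ System.n S
  1≤n = ℕ.≤-trans (ℕ.n≤1+n 1) 2≤n
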